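{- Let $a$ and $b$ be relatively prime positive integers, and let $k$ be an integer with $k\equiv -\frac{b+1}{2}\pmod a$ (where, if $b$ is even, so that $a$ is odd, $\frac{b+1}{2}$ is interpreted using the inverse of $2$ modulo $a$). Index vectors $\mathbf{x}\in\mathbb{R}^a$ cyclically ($x_j:=x_{j\bmod a}$), and define $\Phi(\mathbf{x})=\mathbf{z}=(z_0,\dots,z_{a-1})$ by $$z_i=x_{ib+k}-x_{(i+1)b+k}+\frac{b}{a}.$$ Then $\Phi$ is an affine-linear isomorphism from $\{\mathbf{x}\in\mathbb{R}^a:\sum x_i=0\}$ onto $\{\mathbf{z}\in\mathbb{R}^a:\sum z_i=b\}$ which maps the rational simplex $\{\mathbf{x}:\sum x_i=0,\ x_{i+b}-x_i\le b/a\ \forall i\}$ onto the simplex $\{\mathbf{z}\in\mathbb{R}_{\ge0}^a:\sum z_i=b\}$, and restricts to a bijection from $$\mathbf{SC}_a(b)=\Big\{\mathbf{x}\in\mathbf{s}+\Lambda_a : x_{i+b}-x_i\le \tfrac{b}{a}\ \text{for } i=0,\dots,a-1\Big\}$$ onto $$\mathbf{TD}_a(b)=\Big\{\mathbf{z}\in\mathbb{Z}_{\ge0}^a : \sum_{i=0}^{a-1} z_i=b,\ \sum_{i=0}^{a-1} i z_i\equiv 0 \pmod a\Big\}.$$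
   Context: $\Lambda_a=\{\mathbf{c}\in\mathbb{Z}^a:\sum_i c_i=0\}$ and $\mathbf{s}=(s_0,\dots,s_{a-1})$ with $s_i=\frac{i}{a}-\frac{a-1}{2a}$. (Via $\mathbf{x}=\mathbf{c}+\mathbf{s}$ and the abacus bijection between $\Lambda_a$ and $a$-core partitions, $\mathbf{SC}_a(b)$ corresponds to the set of $(a,b)$-cores; $\mathbf{TD}_a(b)$ can be identified with the $b$-dimensional representations of $\mathbb{Z}/a\mathbb{Z}$ with trivial determinant, $z_i$ being the multiplicity of the character $1\mapsto e^{2\pi i\cdot i/a}$.)
   Formalization: The affine isomorphism between the two hyperplanes and the map of the rational simplex onto the simplex are stated for vectors in ℚ^a instead of ℝ^a. -}

module Defs where

open import Data.Bool using (Bool; true; false; if_then_else_)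
open import Data.Nat as ℕ using (ℕ; zero; suc; NonZero)
import Data.Nat.DivMod as NDM
open import Data.Nat.Divisibility using (_∣_)
open import Data.Fin using (Fin; toℕ)
import Data.Fin as Fin
open import Data.Integer as ℤ using (ℤ; +_; _%ℕ_)
open import Data.Integer.Divisibility using () renaming (_∣_ to _∣ℤ_)
open import Data.Rational as ℚ using (ℚ; ½; _≤_)
open import Data.Product using (Σ; _×_; ∃)
open import Relation.Binary.PropositionalEquality using (_≡_)

isEven : ℕ → Bool
isEven zero = true
isEven (suc zero) = false
isEven (suc (suc n)) = isEven n

-- a natural-number representative of (b+1)/2 modulo a:
-- if b is odd it is literally (b+1)/2; if b is even (so a is odd) it is
-- (b+1) * ((a+1)/2), where (a+1)/2 is the inverse of 2 modulo a.
halfB+1 : (a b : ℕ) → ℕ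
halfB+1 a b = if isEven b then (b ℕ.+ 1) ℕ.* ((a ℕ.+ 1) ℕ./ 2) else (b ℕ.+ 1) ℕ./ 2

KCond : (a b : ℕ) → ℤ → Set
KCond a b k = (+ a) ∣ℤ (k ℤ.+ + halfB+1 a b)

cyc : (a : ℕ) .{{_ : NonZero a}} → ℤ → Fin a
cyc a j = NDM._mod_ (j %ℕ a) a

Σℚ : ∀ {n} → (Fin n → ℚ) → ℚ
Σℚ {zero} f = ℚ.0ℚ
Σℚ {suc n} f = f Fin.zero ℚ.+ Σℚ (λ i → f (Fin.suc i))

Σℕ : ∀ {n} → (Fin n → ℕ) → ℕ
Σℕ {zero} f = 0
Σℕ {suc n} f = f Fin.zero ℕ.+ Σℕ (λ i → f (Fin.suc i))

Σℤ : ∀ {n} → (Fin n → ℤ) → ℤ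
Σℤ {zero} f = + 0
Σℤ {suc n} f = f Fin.zero ℤ.+ Σℤ (λ i → f (Fin.suc i))

ratio : (b a : ℕ) .{{_ : NonZero a}} → ℚ
ratio b a = (+ b) ℚ./ a

at : (a : ℕ) .{{_ : NonZero a}} → (Fin a → ℚ) → ℤ → ℚ
at a x j = x (cyc a j)

Φ : (a b : ℕ) .{{_ : NonZero a}} → ℤ → (Fin a → ℚ) → (Fin a → ℚ)
Φ a b k x i =
  (at a x (+ toℕ i ℤ.* + b ℤ.+ k) ℚ.- at a x ((+ toℕ i ℤ.+ + 1) ℤ.* + b ℤ.+ k))
  ℚ.+ ratio b a

H₀ : (a : ℕ) → (Fin a → ℚ) → Set
H₀ a x = Σℚ x ≡ ℚ.0ℚ

Hb : (a b : ℕ) → (Fin a → ℚ) → Set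
Hb a b z = Σℚ z ≡ + b ℚ./ 1

RatSimplex : (a b : ℕ) .{{_ : NonZero a}} → (Fin a → ℚ) → Set
RatSimplex a b x =
  H₀ a x × (∀ (i : Fin a) → at a x (+ toℕ i ℤ.+ + b) ℚ.- x i ≤ ratio b a)

StdSimplex : (a b : ℕ) → (Fin a → ℚ) → Set
StdSimplex a b z = Hb a b z × (∀ (i : Fin a) → ℚ.0ℚ ≤ z i)

sVec : (a : ℕ) .{{_ : NonZero a}} → Fin a → ℚ
sVec a i = ((+ toℕ i) ℚ./ a) ℚ.- (((+ (a ℕ.∸ 1)) ℚ./ a) ℚ.* ½)

InSLattice : (a : ℕ) .{{_ : NonZero a}} → (Fin a → ℚ) → Set
InSLattice a x =
  Σ (Fin a → ℤ) λ c → (Σℤ c ≡ + 0) × (∀ i → x i ≡ ℚ._+_ (c i ℚ./ 1) (sVec a i))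

SC : (a b : ℕ) .{{_ : NonZero a}} → (Fin a → ℚ) → Set
SC a b x =
  InSLattice a x × (∀ (i : Fin a) → at a x (+ toℕ i ℤ.+ + b) ℚ.- x i ≤ ratio b a)

TD : (a b : ℕ) .{{_ : NonZero a}} → (Fin a → ℕ) → Set
TD a b z = (Σℕ z ≡ b) × (a ∣ Σℕ (λ i → toℕ i ℕ.* z i))

toℚv : ∀ {n} → (Fin n → ℕ) → (Fin n → ℚ)
toℚv z i = (+ z i) ℚ./ 1

{-# OPTIONS --safe #-}
-- Write g m = x ((m b + k) mod a).  Then Φ x i = g i - g (i + 1) + b/a, and since gcd(a, b) = 1 the map
-- m ↦ (m b + k) mod a is a bijection from {0, …, a - 1} onto the residues, with g a = g 0.  Up to this
-- reindexing Φ is the cyclic difference operator plus the constant b/a: Σ Φ x = b by telescoping,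
-- Φ x = Φ y forces x - y to be constant, hence 0 when Σ x = Σ y = 0, and prefix sums give preimages.
-- For j = (m b + k) mod a one has x_{j+b} - x_j = b/a - (Φ x)_m, so the inequalities cutting out the
-- rational simplex become z ≥ 0.
-- On lattice points, Φ s is integral, so Φ maps s + Λ_a to integer vectors; conversely integrality of
-- x - s propagates along the orbit from the single coordinate k mod a.  Summation by parts gives
-- a x_k + Σ i z_i = b (a - 1)/2 whenever Σ x = 0, and the choice k ≡ -(b + 1)/2 turns this into
-- a (x_k - s_k) + Σ i z_i ≡ 0 (mod a), so x_k - s_k ∈ ℤ exactly when a ∣ Σ i z_i.
module Submission where

open import Defs
open import Data.Nat using (ℕ; NonZero)
open import Data.Nat.Coprimality using (Coprime)
open import Data.Fin using (Fin)
open import Data.Integer using (ℤ)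
open import Data.Rational using (ℚ; _+_; _*_; _-_; 1ℚ)
open import Data.Product using (Σ; _×_)
open import Relation.Binary.PropositionalEquality using (_≡_)

import Algebra.Properties.CommutativeMonoid.Sum as Sum
open import Data.Bool using (true; false)
open import Data.Fin as Fin using (toℕ)
open import Data.Fin.Permutation using (permutation)
import Data.Fin.Properties as FinP
open import Data.Integer as ℤ using (+_; _%ℕ_; _/ℕ_)
import Data.Integer.DivMod as ℤDM
open import Data.Integer.Divisibility.Signed
  using (_∣_; divides; ∣-refl; ∣m∣n⇒∣m+n; ∣m∣n⇒∣m-n; ∣m⇒∣m*n; ∣n⇒∣m*n; ∣⇒∣ᵤ; ∣ᵤ⇒∣)
import Data.Integer.Properties as ℤP
open import Data.Integer.Tactic.RingSolver using () renaming (solve-∀ to ℤ-solve)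
open import Data.Nat as ℕ using (suc; zero)
open import Data.Nat.Coprimality using (coprime-Bézout)
import Data.Nat.Divisibility as ℕ∣
import Data.Nat.DivMod as ℕDM
open import Data.Nat.GCD using (module Bézout)
import Data.Nat.Properties as ℕP
open import Data.Nat.Tactic.RingSolver using () renaming (solve-∀ to ℕ-solve)
open import Data.Product using (_,_; ∃-syntax; proj₁; proj₂)
open import Data.Rational as ℚ using (-_; 0ℚ; ½; _/_; _≤_; toℚᵘ)
import Data.Rational.Properties as ℚP
open import Data.Rational.Solver using (module +-*-Solver)
open +-*-Solver using (solve; _:=_; _:+_; _:-_; _:*_; :-_; con)
open import Data.Rational.Unnormalised as ℚᵘ using (mkℚᵘ; *≡*; *≤*) renaming (_≃_ to _≃ᵘ_)
import Data.Rational.Unnormalised.Properties as ℚᵘP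
open import Data.Sum using (_⊎_; inj₁; inj₂)
open import Function using (_∘_)
open import Relation.Binary.PropositionalEquality
  using (refl; sym; trans; cong; cong₂; subst; subst₂; module ≡-Reasoning)
open import Relation.Nullary.Negation using (contradiction)
open import Algebra.Properties.Group ℚP.+-0-group using ()
  renaming (x∙y⁻¹≈ε⇒x≈y to p-q≡0⇒p≡q; x≈y⇒x∙y⁻¹≈ε to p≡q⇒p-q≡0; inverseˡ-unique to p+q≡0⇒p≡-q)

-- Arithmetic in ℚ

fromℤ : ℤ → ℚ
fromℤ i = i / 1

fromℕ : ℕ → ℚ
fromℕ n = fromℤ (+ n)

toℚᵘ-fromℤ : ∀ i → toℚᵘ (fromℤ i) ≃ᵘ mkℚᵘ i 0
toℚᵘ-fromℤ i = ℚP.toℚᵘ-fromℚᵘ (mkℚᵘ i 0)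

toℚᵘ≃⇒≡fromℤ : ∀ {p} i → toℚᵘ p ≃ᵘ mkℚᵘ i 0 → p ≡ fromℤ i
toℚᵘ≃⇒≡fromℤ i p≃i = ℚP.toℚᵘ-injective (ℚᵘP.≃-trans p≃i (ℚᵘP.≃-sym (toℚᵘ-fromℤ i)))

fromℤ-+ : ∀ i j → fromℤ (i ℤ.+ j) ≡ fromℤ i + fromℤ j
fromℤ-+ i j = sym (toℚᵘ≃⇒≡fromℤ (i ℤ.+ j) (begin
  toℚᵘ (fromℤ i + fromℤ j)            ≈⟨ ℚP.toℚᵘ-homo-+ (fromℤ i) (fromℤ j) ⟩
  toℚᵘ (fromℤ i) ℚᵘ.+ toℚᵘ (fromℤ j)  ≈⟨ ℚᵘP.+-cong (toℚᵘ-fromℤ i) (toℚᵘ-fromℤ j) ⟩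
  mkℚᵘ i 0 ℚᵘ.+ mkℚᵘ j 0              ≈⟨ *≡* (cong (ℤ._* + 1) (cong₂ ℤ._+_ (ℤP.*-identityʳ i) (ℤP.*-identityʳ j))) ⟩
  mkℚᵘ (i ℤ.+ j) 0                    ∎))
  where open ℚᵘP.≃-Reasoning

fromℤ-* : ∀ i j → fromℤ (i ℤ.* j) ≡ fromℤ i * fromℤ j
fromℤ-* i j = sym (toℚᵘ≃⇒≡fromℤ (i ℤ.* j) (ℚᵘP.≃-trans (ℚP.toℚᵘ-homo-* (fromℤ i) (fromℤ j))
  (ℚᵘP.*-cong (toℚᵘ-fromℤ i) (toℚᵘ-fromℤ j))))

fromℤ-neg : ∀ i → fromℤ (ℤ.- i) ≡ - fromℤ i
fromℤ-neg i = sym (toℚᵘ≃⇒≡fromℤ (ℤ.- i)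
  (ℚᵘP.≃-trans (ℚP.toℚᵘ-homo‿- (fromℤ i)) (ℚᵘP.-‿cong (toℚᵘ-fromℤ i))))

fromℤ-minus : ∀ i j → fromℤ (i ℤ.- j) ≡ fromℤ i - fromℤ j
fromℤ-minus i j = trans (fromℤ-+ i (ℤ.- j)) (cong (_+_ (fromℤ i)) (fromℤ-neg j))

fromℕ-* : ∀ m n → fromℕ (m ℕ.* n) ≡ fromℕ m * fromℕ n
fromℕ-* m n = trans (cong fromℤ (ℤP.pos-* m n)) (fromℤ-* (+ m) (+ n))

fromℕ-suc : ∀ n → fromℕ (suc n) ≡ fromℕ n + 1ℚ
fromℕ-suc n = trans (cong fromℕ (ℕP.+-comm 1 n)) (fromℤ-+ (+ n) (+ 1))

fromℕ-pred : ∀ n .{{_ : NonZero n}} → fromℕ (n ℕ.∸ 1) ≡ fromℕ n - 1ℚ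
fromℕ-pred (suc n) = trans (cancel (fromℕ n)) (cong (_- 1ℚ) (sym (fromℕ-suc n)))
  where
  cancel : ∀ m → m ≡ (m + 1ℚ) - 1ℚ
  cancel = solve 1 (λ m → m := (m :+ con 1ℚ) :- con 1ℚ) refl

fromℤ-injective : ∀ {i j} → fromℤ i ≡ fromℤ j → i ≡ j
fromℤ-injective {i} {j} eq
  with ℚᵘP.≃-trans (ℚᵘP.≃-sym (toℚᵘ-fromℤ i)) (ℚᵘP.≃-trans (ℚP.toℚᵘ-cong eq) (toℚᵘ-fromℤ j))
... | *≡* i*1≡j*1 = trans (sym (ℤP.*-identityʳ i)) (trans i*1≡j*1 (ℤP.*-identityʳ j))

fromℤ-cancel-≤ : ∀ {i j} → fromℤ i ≤ fromℤ j → i ℤ.≤ j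
fromℤ-cancel-≤ {i} {j} i≤j
  with ℚᵘP.≤-respʳ-≃ (toℚᵘ-fromℤ j) (ℚᵘP.≤-respˡ-≃ (toℚᵘ-fromℤ i) (ℚP.toℚᵘ-mono-≤ i≤j))
... | *≤* i*1≤j*1 = subst₂ ℤ._≤_ (ℤP.*-identityʳ i) (ℤP.*-identityʳ j) i*1≤j*1

fromℕ-nonNeg : ∀ n → 0ℚ ≤ fromℕ n
fromℕ-nonNeg n = ℚP.nonNegative⁻¹ (fromℕ n) {{ℚP.normalize-nonNeg n 1}}

fromℕ-*-/ : ∀ n .{{_ : NonZero n}} i → fromℕ n * (i / n) ≡ fromℤ i
fromℕ-*-/ (suc n) i = toℚᵘ≃⇒≡fromℤ i (begin
  toℚᵘ (fromℕ (suc n) * (i / suc n))          ≈⟨ ℚP.toℚᵘ-homo-* (fromℕ (suc n)) (i / suc n) ⟩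
  toℚᵘ (fromℕ (suc n)) ℚᵘ.* toℚᵘ (i / suc n)  ≈⟨ ℚᵘP.*-cong (toℚᵘ-fromℤ (+ suc n)) (ℚP.toℚᵘ-fromℚᵘ (mkℚᵘ i n)) ⟩
  mkℚᵘ (+ suc n) 0 ℚᵘ.* mkℚᵘ i n              ≈⟨ *≡* cross ⟩
  mkℚᵘ i 0                                    ∎)
  where
  open ℚᵘP.≃-Reasoning
  cross : (+ suc n ℤ.* i) ℤ.* + 1 ≡ i ℤ.* + suc (n ℕ.+ 0)
  cross = trans (ℤP.*-identityʳ (+ suc n ℤ.* i))
                (trans (ℤP.*-comm (+ suc n) i) (cong (λ m → i ℤ.* + suc m) (sym (ℕP.+-identityʳ n))))

fromℕ-*-cancelˡ : ∀ n .{{_ : NonZero n}} {p q} → fromℕ n * p ≡ fromℕ n * q → p ≡ q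
fromℕ-*-cancelˡ n {p} {q} np≡nq = begin
  p                   ≡⟨ unscale p ⟩
  n⁻¹ * (fromℕ n * p) ≡⟨ cong (n⁻¹ *_) np≡nq ⟩
  n⁻¹ * (fromℕ n * q) ≡⟨ unscale q ⟨
  q                   ∎
  where
  open ≡-Reasoning
  n⁻¹ = + 1 / n
  reassoc : ∀ m m⁻¹ r → (m * m⁻¹) * r ≡ m⁻¹ * (m * r)
  reassoc = solve 3 (λ m m⁻¹ r → (m :* m⁻¹) :* r := m⁻¹ :* (m :* r)) refl
  unscale : ∀ r → r ≡ n⁻¹ * (fromℕ n * r)
  unscale r = trans (sym (ℚP.*-identityˡ r))
                    (trans (cong (_* r) (sym (fromℕ-*-/ n (+ 1)))) (reassoc (fromℕ n) n⁻¹ r))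

n*p≡q*n⇒p≡q : ∀ n .{{_ : NonZero n}} {p} q → fromℕ n * p ≡ fromℤ (q ℤ.* + n) → p ≡ fromℤ q
n*p≡q*n⇒p≡q n {p} q np≡qn =
  fromℕ-*-cancelˡ n (trans np≡qn (trans (fromℤ-* q (+ n)) (ℚP.*-comm (fromℤ q) (fromℕ n))))

Integral : ℚ → Set
Integral p = ∃[ i ] p ≡ fromℤ i

integral-fromℕ : ∀ n → Integral (fromℕ n)
integral-fromℕ n = + n , refl

integral-+ : ∀ {p q} → Integral p → Integral q → Integral (p + q)
integral-+ (i , refl) (j , refl) = i ℤ.+ j , sym (fromℤ-+ i j)

integral-minus : ∀ {p q} → Integral p → Integral q → Integral (p - q)
integral-minus (i , refl) (j , refl) = i ℤ.- j , sym (fromℤ-minus i j)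

integral-nonNeg⇒fromℕ : ∀ {p} → Integral p → 0ℚ ≤ p → ∃[ n ] p ≡ fromℕ n
integral-nonNeg⇒fromℕ (i , refl) 0≤i = ℤ.∣ i ∣ , cong fromℤ (sym (ℤP.0≤i⇒+∣i∣≡i {i} (fromℤ-cancel-≤ 0≤i)))

p-q≤p⇒0≤q : ∀ {p q} → p - q ≤ p → 0ℚ ≤ q
p-q≤p⇒0≤q {p} {q} p-q≤p = subst₂ _≤_ (cancel₁ p q) (cancel₂ p q) (ℚP.+-monoˡ-≤ (q - p) p-q≤p)
  where
  cancel₁ : ∀ p q → (p - q) + (q - p) ≡ 0ℚ
  cancel₁ = solve 2 (λ p q → (p :- q) :+ (q :- p) := con 0ℚ) refl
  cancel₂ : ∀ p q → p + (q - p) ≡ q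
  cancel₂ = solve 2 (λ p q → p :+ (q :- p) := q) refl

0≤q⇒p-q≤p : ∀ {p q} → 0ℚ ≤ q → p - q ≤ p
0≤q⇒p-q≤p {p} {q} 0≤q = subst (p - q ≤_) (ℚP.+-identityʳ p) (ℚP.+-monoʳ-≤ p (ℚP.neg-antimono-≤ 0≤q))

-- Finite sums

Σℚ-cong : ∀ {n} {f g : Fin n → ℚ} → (∀ i → f i ≡ g i) → Σℚ f ≡ Σℚ g
Σℚ-cong {zero}  f≗g = refl
Σℚ-cong {suc n} f≗g = cong₂ _+_ (f≗g Fin.zero) (Σℚ-cong (f≗g ∘ Fin.suc))

Σℚ-+ : ∀ {n} (f g : Fin n → ℚ) → Σℚ (λ i → f i + g i) ≡ Σℚ f + Σℚ g
Σℚ-+ {zero}  f g = refl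
Σℚ-+ {suc n} f g = trans (cong (_+_ (f Fin.zero + g Fin.zero)) (Σℚ-+ (f ∘ Fin.suc) (g ∘ Fin.suc)))
                         (interchange (f Fin.zero) (g Fin.zero) (Σℚ (f ∘ Fin.suc)) (Σℚ (g ∘ Fin.suc)))
  where
  interchange : ∀ w x y z → (w + x) + (y + z) ≡ (w + y) + (x + z)
  interchange = solve 4 (λ w x y z → (w :+ x) :+ (y :+ z) := (w :+ y) :+ (x :+ z)) refl

Σℚ-minus : ∀ {n} (f g : Fin n → ℚ) → Σℚ (λ i → f i - g i) ≡ Σℚ f - Σℚ g
Σℚ-minus {zero}  f g = refl
Σℚ-minus {suc n} f g = trans (cong (_+_ (f Fin.zero - g Fin.zero)) (Σℚ-minus (f ∘ Fin.suc) (g ∘ Fin.suc)))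
                         (interchange (f Fin.zero) (g Fin.zero) (Σℚ (f ∘ Fin.suc)) (Σℚ (g ∘ Fin.suc)))
  where
  interchange : ∀ w x y z → (w - x) + (y - z) ≡ (w + y) - (x + z)
  interchange = solve 4 (λ w x y z → (w :- x) :+ (y :- z) := (w :+ y) :- (x :+ z)) refl

Σℚ-*ʳ : ∀ {n} (f : Fin n → ℚ) c → Σℚ (λ i → f i * c) ≡ Σℚ f * c
Σℚ-*ʳ {zero}  f c = sym (ℚP.*-zeroˡ c)
Σℚ-*ʳ {suc n} f c = trans (cong (_+_ (f Fin.zero * c)) (Σℚ-*ʳ (f ∘ Fin.suc) c))
                          (sym (ℚP.*-distribʳ-+ c (f Fin.zero) (Σℚ (f ∘ Fin.suc))))

Σℚ-const : ∀ n c → Σℚ {n} (λ _ → c) ≡ fromℕ n * c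
Σℚ-const zero    c = sym (ℚP.*-zeroˡ c)
Σℚ-const (suc n) c = begin
  c + Σℚ {n} (λ _ → c)  ≡⟨ cong (_+_ c) (Σℚ-const n c) ⟩
  c + fromℕ n * c       ≡⟨ factor (fromℕ n) c ⟩
  (fromℕ n + 1ℚ) * c    ≡⟨ cong (_* c) (fromℕ-suc n) ⟨
  fromℕ (suc n) * c     ∎
  where
  open ≡-Reasoning
  factor : ∀ m c → c + m * c ≡ (m + 1ℚ) * c
  factor = solve 2 (λ m c → c :+ m :* c := (m :+ con 1ℚ) :* c) refl

fromℤ-Σℤ : ∀ {n} (c : Fin n → ℤ) → Σℚ (λ i → fromℤ (c i)) ≡ fromℤ (Σℤ c)
fromℤ-Σℤ {zero}  c = refl
fromℤ-Σℤ {suc n} c = trans (cong (_+_ (fromℤ (c Fin.zero))) (fromℤ-Σℤ (c ∘ Fin.suc)))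
                            (sym (fromℤ-+ (c Fin.zero) (Σℤ (c ∘ Fin.suc))))

fromℕ-Σℕ : ∀ {n} (z : Fin n → ℕ) → Σℚ (λ i → fromℕ (z i)) ≡ fromℕ (Σℕ z)
fromℕ-Σℕ {zero}  z = refl
fromℕ-Σℕ {suc n} z = trans (cong (_+_ (fromℕ (z Fin.zero))) (fromℕ-Σℕ (z ∘ Fin.suc)))
                            (sym (fromℤ-+ (+ z Fin.zero) (+ Σℕ (z ∘ Fin.suc))))

Σℚ-index-fromℕ : ∀ {n} (f : Fin n → ℚ) (z : Fin n → ℕ) → (∀ i → f i ≡ fromℕ (z i)) →
                 Σℚ (λ i → fromℕ (toℕ i) * f i) ≡ fromℕ (Σℕ (λ i → toℕ i ℕ.* z i))
Σℚ-index-fromℕ f z f≗z =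
  trans (Σℚ-cong (λ i → trans (cong (_*_ (fromℕ (toℕ i))) (f≗z i)) (sym (fromℕ-* (toℕ i) (z i)))))
        (fromℕ-Σℕ (λ i → toℕ i ℕ.* z i))

module ℚ-Sum = Sum ℚP.+-0-commutativeMonoid

Σℚ≡sum : ∀ {n} (f : Fin n → ℚ) → Σℚ f ≡ ℚ-Sum.sum f
Σℚ≡sum {zero}  f = refl
Σℚ≡sum {suc n} f = cong (_+_ (f Fin.zero)) (Σℚ≡sum (f ∘ Fin.suc))

Σℚ-permute : ∀ {n} (σ σ⁻¹ : Fin n → Fin n) → (∀ j → σ (σ⁻¹ j) ≡ j) → (∀ i → σ⁻¹ (σ i) ≡ i) →
             (f : Fin n → ℚ) → Σℚ (f ∘ σ) ≡ Σℚ f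
Σℚ-permute σ σ⁻¹ σσ⁻¹ σ⁻¹σ f = begin
  Σℚ (f ∘ σ)      ≡⟨ Σℚ≡sum (f ∘ σ) ⟩
  ℚ-Sum.sum (f ∘ σ) ≡⟨ ℚ-Sum.sum-permute f (permutation σ σ⁻¹ σσ⁻¹ σ⁻¹σ) ⟨
  ℚ-Sum.sum f     ≡⟨ Σℚ≡sum f ⟨
  Σℚ f            ∎
  where open ≡-Reasoning

Σℚ-snoc : ∀ n (F : ℕ → ℚ) → Σℚ {suc n} (F ∘ toℕ) ≡ Σℚ {n} (F ∘ toℕ) + F n
Σℚ-snoc zero    F = ℚP.+-comm (F 0) 0ℚ
Σℚ-snoc (suc n) F = trans (cong (_+_ (F 0)) (Σℚ-snoc n (F ∘ suc)))
                          (sym (ℚP.+-assoc (F 0) (Σℚ {n} (F ∘ suc ∘ toℕ)) (F (suc n))))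

Σℚ-telescope : ∀ n (g : ℕ → ℚ) → Σℚ {n} (λ i → g (toℕ i) - g (toℕ i ℕ.+ 1)) ≡ g 0 - g n
Σℚ-telescope zero    g = sym (ℚP.+-inverseʳ (g 0))
Σℚ-telescope (suc n) g = trans (cong (_+_ (g 0 - g 1)) (Σℚ-telescope n (g ∘ suc)))
                               (collapse (g 0) (g 1) (g (suc n)))
  where
  collapse : ∀ p q r → (p - q) + (q - r) ≡ p - r
  collapse = solve 3 (λ p q r → (p :- q) :+ (q :- r) := p :- r) refl

Σℚ-weighted-telescope : ∀ n (g : ℕ → ℚ) →
  Σℚ {n} (λ i → fromℕ (toℕ i) * (g (toℕ i) - g (toℕ i ℕ.+ 1))) + fromℕ n * g n ≡ Σℚ {n} (λ i → g (toℕ i ℕ.+ 1))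
Σℚ-weighted-telescope zero    g = trans (ℚP.+-identityˡ (0ℚ * g 0)) (ℚP.*-zeroˡ (g 0))
Σℚ-weighted-telescope (suc n) g = begin
  (0ℚ * (g 0 - g 1) + Σℚ (λ i → fromℕ (suc (toℕ i)) * Δ i)) + fromℕ (suc n) * g (suc n)
    ≡⟨ cong₂ (λ s m → (0ℚ * (g 0 - g 1) + s) + m * g (suc n)) split (fromℕ-suc n) ⟩
  (0ℚ * (g 0 - g 1) + (W + Σℚ Δ)) + (fromℕ n + 1ℚ) * g (suc n)
    ≡⟨ cong (λ s → (0ℚ * (g 0 - g 1) + (W + s)) + (fromℕ n + 1ℚ) * g (suc n)) (Σℚ-telescope n (g ∘ suc)) ⟩
  (0ℚ * (g 0 - g 1) + (W + (g 1 - g (suc n)))) + (fromℕ n + 1ℚ) * g (suc n)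
    ≡⟨ regroup (g 0) (g 1) (g (suc n)) W (fromℕ n) ⟩
  g 1 + (W + fromℕ n * g (suc n))
    ≡⟨ cong (_+_ (g 1)) (Σℚ-weighted-telescope n (g ∘ suc)) ⟩
  g 1 + Σℚ {n} (λ i → g (suc (toℕ i) ℕ.+ 1))
    ∎
  where
  open ≡-Reasoning
  Δ : Fin n → ℚ
  Δ i = g (suc (toℕ i)) - g (suc (toℕ i) ℕ.+ 1)
  W = Σℚ (λ i → fromℕ (toℕ i) * Δ i)
  split : Σℚ (λ i → fromℕ (suc (toℕ i)) * Δ i) ≡ W + Σℚ Δ
  split = begin
    Σℚ (λ i → fromℕ (suc (toℕ i)) * Δ i)                  ≡⟨ Σℚ-cong (λ i → cong (_* Δ i) (fromℕ-suc (toℕ i))) ⟩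
    Σℚ (λ i → (fromℕ (toℕ i) + 1ℚ) * Δ i)                 ≡⟨ Σℚ-cong (λ i → ℚP.*-distribʳ-+ (Δ i) (fromℕ (toℕ i)) 1ℚ) ⟩
    Σℚ (λ i → fromℕ (toℕ i) * Δ i + 1ℚ * Δ i)             ≡⟨ Σℚ-+ (λ i → fromℕ (toℕ i) * Δ i) (λ i → 1ℚ * Δ i) ⟩
    W + Σℚ (λ i → 1ℚ * Δ i)                               ≡⟨ cong (_+_ W) (Σℚ-cong (λ i → ℚP.*-identityˡ (Δ i))) ⟩
    W + Σℚ Δ                                              ∎
  regroup : ∀ g₀ g₁ gₙ w n → (0ℚ * (g₀ - g₁) + (w + (g₁ - gₙ))) + (n + 1ℚ) * gₙ ≡ g₁ + (w + n * gₙ)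
  regroup = solve 5 (λ g₀ g₁ gₙ w n → (con 0ℚ :* (g₀ :- g₁) :+ (w :+ (g₁ :- gₙ))) :+ (n :+ con 1ℚ) :* gₙ
                     := g₁ :+ (w :+ n :* gₙ)) refl

Σℚ-indices : ∀ n → Σℚ {n} (λ i → fromℕ (toℕ i)) ≡ fromℕ n * (fromℕ n - 1ℚ) * ½
Σℚ-indices zero    = refl
Σℚ-indices (suc n) = begin
  0ℚ + Σℚ {n} (λ i → fromℕ (suc (toℕ i)))                 ≡⟨ cong (_+_ 0ℚ) (Σℚ-cong {n} (λ i → fromℕ-suc (toℕ i))) ⟩
  0ℚ + Σℚ {n} (λ i → fromℕ (toℕ i) + 1ℚ)                  ≡⟨ cong (_+_ 0ℚ) (Σℚ-+ {n} (λ i → fromℕ (toℕ i)) (λ _ → 1ℚ)) ⟩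
  0ℚ + (Σℚ {n} (λ i → fromℕ (toℕ i)) + Σℚ {n} (λ _ → 1ℚ)) ≡⟨ cong₂ (λ s t → 0ℚ + (s + t)) (Σℚ-indices n) (Σℚ-const n 1ℚ) ⟩
  0ℚ + (fromℕ n * (fromℕ n - 1ℚ) * ½ + fromℕ n * 1ℚ)      ≡⟨ triangular (fromℕ n) ⟩
  (fromℕ n + 1ℚ) * ((fromℕ n + 1ℚ) - 1ℚ) * ½              ≡⟨ cong (λ m → m * (m - 1ℚ) * ½) (fromℕ-suc n) ⟨
  fromℕ (suc n) * (fromℕ (suc n) - 1ℚ) * ½                ∎
  where
  open ≡-Reasoning
  triangular : ∀ m → 0ℚ + (m * (m - 1ℚ) * ½ + m * 1ℚ) ≡ (m + 1ℚ) * ((m + 1ℚ) - 1ℚ) * ½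
  triangular = solve 1 (λ m → con 0ℚ :+ (m :* (m :- con 1ℚ) :* con ½ :+ m :* con 1ℚ)
                        := (m :+ con 1ℚ) :* ((m :+ con 1ℚ) :- con 1ℚ) :* con ½) refl

mean : ∀ {n} .{{_ : NonZero n}} → (Fin n → ℚ) → ℚ
mean {n} x = (+ 1 / n) * Σℚ x

Σℚ-centered : ∀ {n} .{{_ : NonZero n}} (x : Fin n → ℚ) → Σℚ (λ j → x j - mean x) ≡ 0ℚ
Σℚ-centered {n} x = begin
  Σℚ (λ j → x j - mean x)                  ≡⟨ Σℚ-minus x (λ _ → mean x) ⟩
  Σℚ x - Σℚ {n} (λ _ → mean x)             ≡⟨ cong (_-_ (Σℚ x)) (Σℚ-const n (mean x)) ⟩
  Σℚ x - fromℕ n * ((+ 1 / n) * Σℚ x)      ≡⟨ cong (_-_ (Σℚ x)) (sym (ℚP.*-assoc (fromℕ n) (+ 1 / n) (Σℚ x))) ⟩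
  Σℚ x - (fromℕ n * (+ 1 / n)) * Σℚ x      ≡⟨ cong (λ u → Σℚ x - u * Σℚ x) (fromℕ-*-/ n (+ 1)) ⟩
  Σℚ x - 1ℚ * Σℚ x                         ≡⟨ cong (_-_ (Σℚ x)) (ℚP.*-identityˡ (Σℚ x)) ⟩
  Σℚ x - Σℚ x                              ≡⟨ ℚP.+-inverseʳ (Σℚ x) ⟩
  0ℚ                                       ∎
  where open ≡-Reasoning

-- Residues modulo a

module _ (a : ℕ) .{{_ : NonZero a}} where

  toℕ-cyc : ∀ i → toℕ (cyc a i) ≡ i %ℕ a
  toℕ-cyc i = trans (FinP.toℕ-fromℕ< _) (ℕDM.m<n⇒m%n≡m (ℤDM.n%ℕd<d i a))

  cyc-≡ : ∀ i → + a ∣ + toℕ (cyc a i) ℤ.- i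
  cyc-≡ i = divides (ℤ.- (i /ℕ a)) (begin
    + toℕ (cyc a i) ℤ.- i                      ≡⟨ cong₂ ℤ._-_ (cong +_ (toℕ-cyc i)) (ℤDM.a≡a%ℕn+[a/ℕn]*n i a) ⟩
    + (i %ℕ a) ℤ.- (+ (i %ℕ a) ℤ.+ (i /ℕ a) ℤ.* + a) ≡⟨ cancel (+ (i %ℕ a)) (i /ℕ a) (+ a) ⟩
    ℤ.- (i /ℕ a) ℤ.* + a                       ∎)
    where
    open ≡-Reasoning
    cancel : ∀ r q d → r ℤ.- (r ℤ.+ q ℤ.* d) ≡ ℤ.- q ℤ.* d
    cancel = ℤ-solve

  remainders-unique : ∀ {r s} → r ℕ.< a → s ℕ.< a → + a ∣ + r ℤ.- + s → r ≡ s
  remainders-unique {r} {s} r<a s<a a∣r-s = ℤP.+-injective (ℤP.i-j≡0⇒i≡j (+ r) (+ s) r-s≡0)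
    where
    a∣∣r⊖s∣ : a ℕ∣.∣ ℤ.∣ r ℤ.⊖ s ∣
    a∣∣r⊖s∣ = subst (λ d → a ℕ∣.∣ ℤ.∣ d ∣) (ℤP.m-n≡m⊖n r s) (∣⇒∣ᵤ a∣r-s)
    ∣r⊖s∣<a : ℤ.∣ r ℤ.⊖ s ∣ ℕ.< a
    ∣r⊖s∣<a = ℕP.≤-<-trans (ℤP.∣m⊝n∣≤m⊔n r s) (ℕP.⊔-lub r<a s<a)
    small-multiple≡0 : ∀ d → a ℕ∣.∣ d → d ℕ.< a → d ≡ 0
    small-multiple≡0 zero    _   _   = refl
    small-multiple≡0 (suc d) a∣d d<a = contradiction (ℕ∣.∣⇒≤ a∣d) (ℕP.<⇒≱ d<a)
    r-s≡0 : + r ℤ.- + s ≡ + 0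
    r-s≡0 = trans (ℤP.m-n≡m⊖n r s) (ℤP.∣i∣≡0⇒i≡0 (small-multiple≡0 _ a∣∣r⊖s∣ ∣r⊖s∣<a))

  cyc-cong : ∀ i j → + a ∣ i ℤ.- j → cyc a i ≡ cyc a j
  cyc-cong i j a∣i-j = FinP.toℕ-injective (remainders-unique (FinP.toℕ<n (cyc a i)) (FinP.toℕ<n (cyc a j))
    (subst (+ a ∣_) (regroup (+ toℕ (cyc a i)) (+ toℕ (cyc a j)) i j)
      (∣m∣n⇒∣m+n (∣m∣n⇒∣m-n (cyc-≡ i) (cyc-≡ j)) a∣i-j)))
    where
    regroup : ∀ r s i j → (r ℤ.- i) ℤ.- (s ℤ.- j) ℤ.+ (i ℤ.- j) ≡ r ℤ.- s
    regroup = ℤ-solve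

  cyc-toℕ : ∀ (i : Fin a) → cyc a (+ toℕ i) ≡ i
  cyc-toℕ i = FinP.toℕ-injective (trans (toℕ-cyc (+ toℕ i)) (ℕDM.m<n⇒m%n≡m (FinP.toℕ<n i)))

pos-1+*≡* : ∀ u v w z → 1 ℕ.+ u ℕ.* v ≡ w ℕ.* z → + 1 ℤ.+ + u ℤ.* + v ≡ + w ℤ.* + z
pos-1+*≡* u v w z eq = trans (cong (ℤ._+_ (+ 1)) (sym (ℤP.pos-* u v))) (trans (cong +_ eq) (ℤP.pos-* w z))

bézout-inverse : ∀ {a b} → Coprime a b → ∃[ b⁻¹ ] + a ∣ + b ℤ.* b⁻¹ ℤ.- + 1
bézout-inverse {a} {b} coprime with coprime-Bézout coprime
... | Bézout.+- x y 1+yb≡xa = ℤ.- + y , divides (ℤ.- + x) (begin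
  + b ℤ.* ℤ.- + y ℤ.- + 1   ≡⟨ negate (+ b) (+ y) ⟩
  ℤ.- (+ 1 ℤ.+ + y ℤ.* + b) ≡⟨ cong ℤ.-_ (pos-1+*≡* y b x a 1+yb≡xa) ⟩
  ℤ.- (+ x ℤ.* + a)         ≡⟨ ℤP.neg-distribˡ-* (+ x) (+ a) ⟩
  ℤ.- + x ℤ.* + a           ∎)
  where
  open ≡-Reasoning
  negate : ∀ b y → b ℤ.* ℤ.- y ℤ.- + 1 ≡ ℤ.- (+ 1 ℤ.+ y ℤ.* b)
  negate = ℤ-solve
... | Bézout.-+ x y 1+xa≡yb = + y , divides (+ x) (begin
  + b ℤ.* + y ℤ.- + 1          ≡⟨ cong (ℤ._- + 1) (ℤP.*-comm (+ b) (+ y)) ⟩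
  + y ℤ.* + b ℤ.- + 1          ≡⟨ cong (ℤ._- + 1) (pos-1+*≡* x a y b 1+xa≡yb) ⟨
  + 1 ℤ.+ + x ℤ.* + a ℤ.- + 1  ≡⟨ cancel (+ x ℤ.* + a) ⟩
  + x ℤ.* + a                  ∎)
  where
  open ≡-Reasoning
  cancel : ∀ u → + 1 ℤ.+ u ℤ.- + 1 ≡ u
  cancel = ℤ-solve

-- The vector s and the constant halfB+1

fromℕ-*-sVec : ∀ a .{{_ : NonZero a}} j → fromℕ a * sVec a j ≡ fromℕ (toℕ j) - (fromℕ a - 1ℚ) * ½
fromℕ-*-sVec a j = begin
  fromℕ a * (+ toℕ j / a - (+ (a ℕ.∸ 1) / a) * ½)
    ≡⟨ distribute (fromℕ a) (+ toℕ j / a) (+ (a ℕ.∸ 1) / a) ⟩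
  fromℕ a * (+ toℕ j / a) - (fromℕ a * (+ (a ℕ.∸ 1) / a)) * ½
    ≡⟨ cong₂ (λ u v → u - v * ½) (fromℕ-*-/ a (+ toℕ j)) (fromℕ-*-/ a (+ (a ℕ.∸ 1))) ⟩
  fromℕ (toℕ j) - fromℕ (a ℕ.∸ 1) * ½
    ≡⟨ cong (λ u → fromℕ (toℕ j) - u * ½) (fromℕ-pred a) ⟩
  fromℕ (toℕ j) - (fromℕ a - 1ℚ) * ½
    ∎
  where
  open ≡-Reasoning
  distribute : ∀ m u v → m * (u - v * ½) ≡ m * u - (m * v) * ½
  distribute = solve 3 (λ m u v → m :* (u :- v :* con ½) := m :* u :- (m :* v) :* con ½) refl

Σℚ-sVec : ∀ a .{{_ : NonZero a}} → Σℚ (sVec a) ≡ 0ℚ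
Σℚ-sVec a = fromℕ-*-cancelˡ a (begin
  fromℕ a * Σℚ (sVec a)
    ≡⟨ ℚP.*-comm (fromℕ a) (Σℚ (sVec a)) ⟩
  Σℚ (sVec a) * fromℕ a
    ≡⟨ Σℚ-*ʳ (sVec a) (fromℕ a) ⟨
  Σℚ (λ j → sVec a j * fromℕ a)
    ≡⟨ Σℚ-cong (λ j → trans (ℚP.*-comm (sVec a j) (fromℕ a)) (fromℕ-*-sVec a j)) ⟩
  Σℚ {a} (λ j → fromℕ (toℕ j) - (fromℕ a - 1ℚ) * ½)
    ≡⟨ Σℚ-minus {a} (λ j → fromℕ (toℕ j)) (λ _ → (fromℕ a - 1ℚ) * ½) ⟩
  Σℚ {a} (λ j → fromℕ (toℕ j)) - Σℚ {a} (λ _ → (fromℕ a - 1ℚ) * ½)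
    ≡⟨ cong₂ _-_ (Σℚ-indices a) (Σℚ-const a ((fromℕ a - 1ℚ) * ½)) ⟩
  fromℕ a * (fromℕ a - 1ℚ) * ½ - fromℕ a * ((fromℕ a - 1ℚ) * ½)
    ≡⟨ cancel (fromℕ a) ⟩
  fromℕ a * 0ℚ
    ∎)
  where
  open ≡-Reasoning
  cancel : ∀ m → m * (m - 1ℚ) * ½ - m * ((m - 1ℚ) * ½) ≡ m * 0ℚ
  cancel = solve 1 (λ m → m :* (m :- con 1ℚ) :* con ½ :- m :* ((m :- con 1ℚ) :* con ½) := m :* con 0ℚ) refl

inSLattice⇒H₀ : ∀ a .{{_ : NonZero a}} (x : Fin a → ℚ) → InSLattice a x → H₀ a x
inSLattice⇒H₀ a x (c , Σc≡0 , x≗c+s) = begin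
  Σℚ x                                  ≡⟨ Σℚ-cong x≗c+s ⟩
  Σℚ (λ j → fromℤ (c j) + sVec a j)     ≡⟨ Σℚ-+ (λ j → fromℤ (c j)) (sVec a) ⟩
  Σℚ (λ j → fromℤ (c j)) + Σℚ (sVec a)  ≡⟨ cong₂ _+_ (trans (fromℤ-Σℤ c) (cong fromℤ Σc≡0)) (Σℚ-sVec a) ⟩
  0ℚ                                    ∎
  where open ≡-Reasoning

parity : ∀ n → (isEven n ≡ true × ∃[ m ] n ≡ m ℕ.+ m) ⊎ (isEven n ≡ false × ∃[ m ] n ≡ suc (m ℕ.+ m))
parity zero          = inj₁ (refl , 0 , refl)
parity (suc zero)    = inj₂ (refl , 0 , refl)
parity (suc (suc n)) with parity n
... | inj₁ (even , m , refl) = inj₁ (even , suc m , cong suc (sym (ℕP.+-suc m m)))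
... | inj₂ (odd  , m , refl) = inj₂ (odd  , suc m , cong (suc ∘ suc) (sym (ℕP.+-suc m m)))

[1+2m+1]/2≡1+m : ∀ m → (suc (m ℕ.+ m) ℕ.+ 1) ℕ./ 2 ≡ suc m
[1+2m+1]/2≡1+m m = trans (cong (ℕ._/ 2) (double m)) (ℕDM.m*n/n≡m (suc m) 2)
  where
  double : ∀ m → suc (m ℕ.+ m) ℕ.+ 1 ≡ suc m ℕ.* 2
  double = ℕ-solve

-- That is, (a - 1)(b + 1)/2 ≡ -halfB+1 a b (mod a); for even b this needs a odd.
halfB+1-spec : ∀ a b .{{_ : NonZero a}} → Coprime a b →
               ∃[ K ] (a ℕ.∸ 1) ℕ.* (b ℕ.+ 1) ℕ.+ (halfB+1 a b ℕ.+ halfB+1 a b) ≡ a ℕ.* K ℕ.+ a ℕ.* K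
halfB+1-spec (suc n) b coprime with parity b
... | inj₂ (odd , m , refl) rewrite odd | [1+2m+1]/2≡1+m m = suc m , identity n m
  where
  identity : ∀ n m → n ℕ.* (suc (m ℕ.+ m) ℕ.+ 1) ℕ.+ (suc m ℕ.+ suc m)
                     ≡ suc n ℕ.* suc m ℕ.+ suc n ℕ.* suc m
  identity = ℕ-solve
... | inj₁ (even , m , refl) with parity (suc n)
...   | inj₁ (_ , u , 1+n≡u+u) =
  contradiction (coprime (subst (2 ℕ∣.∣_) (sym 1+n≡u+u) (2∣u+u u) , 2∣u+u m)) λ ()
  where
  2∣u+u : ∀ u → 2 ℕ∣.∣ u ℕ.+ u
  2∣u+u u = ℕ∣.divides u (trans (cong (u ℕ.+_) (sym (ℕP.+-identityʳ u))) (ℕP.*-comm 2 u))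
...   | inj₂ (_ , u , 1+n≡1+u+u) rewrite even | ℕP.suc-injective 1+n≡1+u+u | [1+2m+1]/2≡1+m u =
  m ℕ.+ m ℕ.+ 1 , identity u m
  where
  identity : ∀ u m → (u ℕ.+ u) ℕ.* (m ℕ.+ m ℕ.+ 1) ℕ.+ ((m ℕ.+ m ℕ.+ 1) ℕ.* suc u ℕ.+ (m ℕ.+ m ℕ.+ 1) ℕ.* suc u)
                     ≡ suc (u ℕ.+ u) ℕ.* (m ℕ.+ m ℕ.+ 1) ℕ.+ suc (u ℕ.+ u) ℕ.* (m ℕ.+ m ℕ.+ 1)
  identity = ℕ-solve

module Φ-basics (a b : ℕ) .{{_ : NonZero a}} (k : ℤ) where

  -- Φ a b k x i is definitionally (x (orbit (toℕ i)) - x (orbit (toℕ i ℕ.+ 1))) + β.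
  orbit : ℕ → Fin a
  orbit m = cyc a (+ m ℤ.* + b ℤ.+ k)

  orbit-periodic : orbit a ≡ orbit 0
  orbit-periodic = cyc-cong a (+ a ℤ.* + b ℤ.+ k) (+ 0 ℤ.* + b ℤ.+ k) (divides (+ b) (shift (+ a) (+ b) k))
    where
    shift : ∀ a b k → (a ℤ.* b ℤ.+ k) ℤ.- (+ 0 ℤ.* b ℤ.+ k) ≡ b ℤ.* a
    shift = ℤ-solve

  cyc-orbit+b : ∀ m → cyc a (+ toℕ (orbit m) ℤ.+ + b) ≡ orbit (m ℕ.+ 1)
  cyc-orbit+b m = cyc-cong a (+ toℕ (orbit m) ℤ.+ + b) ((+ m ℤ.+ + 1) ℤ.* + b ℤ.+ k)
    (subst (+ a ∣_) (shift (+ toℕ (orbit m)) (+ m) (+ b) k) (cyc-≡ a (+ m ℤ.* + b ℤ.+ k)))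
    where
    shift : ∀ r m b k → r ℤ.- (m ℤ.* b ℤ.+ k) ≡ (r ℤ.+ b) ℤ.- ((m ℤ.+ + 1) ℤ.* b ℤ.+ k)
    shift = ℤ-solve

  β : ℚ
  β = ratio b a

  fromℕ-*-β : fromℕ a * β ≡ fromℕ b
  fromℕ-*-β = fromℕ-*-/ a (+ b)

  Φ-cong : ∀ {x y : Fin a → ℚ} → (∀ j → x j ≡ y j) → ∀ i → Φ a b k x i ≡ Φ a b k y i
  Φ-cong x≗y i = cong₂ (λ p q → (p - q) + β) (x≗y (orbit (toℕ i))) (x≗y (orbit (toℕ i ℕ.+ 1)))

  Φ-affine : ∀ (x y : Fin a → ℚ) (t : ℚ) (i : Fin a) →
             Φ a b k (λ j → t * x j + (1ℚ - t) * y j) i ≡ t * Φ a b k x i + (1ℚ - t) * Φ a b k y i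
  Φ-affine x y t i =
    affine t (x (orbit (toℕ i))) (y (orbit (toℕ i))) (x (orbit (toℕ i ℕ.+ 1))) (y (orbit (toℕ i ℕ.+ 1))) β
    where
    affine : ∀ t p q p′ q′ c → ((t * p + (1ℚ - t) * q) - (t * p′ + (1ℚ - t) * q′)) + c ≡
                               t * ((p - p′) + c) + (1ℚ - t) * ((q - q′) + c)
    affine = solve 6 (λ t p q p′ q′ c → ((t :* p :+ (con 1ℚ :- t) :* q) :- (t :* p′ :+ (con 1ℚ :- t) :* q′)) :+ c
                      := t :* ((p :- p′) :+ c) :+ (con 1ℚ :- t) :* ((q :- q′) :+ c)) refl

  Φ-+ : ∀ (u v : Fin a → ℚ) i →
        Φ a b k (λ j → u j + v j) i ≡ (u (orbit (toℕ i)) - u (orbit (toℕ i ℕ.+ 1))) + Φ a b k v i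
  Φ-+ u v i = regroup (u (orbit (toℕ i))) (v (orbit (toℕ i))) (u (orbit (toℕ i ℕ.+ 1))) (v (orbit (toℕ i ℕ.+ 1))) β
    where
    regroup : ∀ p q p′ q′ c → ((p + q) - (p′ + q′)) + c ≡ (p - p′) + ((q - q′) + c)
    regroup = solve 5 (λ p q p′ q′ c → ((p :+ q) :- (p′ :+ q′)) :+ c := (p :- p′) :+ ((q :- q′) :+ c)) refl

  Φ-shift : ∀ (x : Fin a → ℚ) c i → Φ a b k (λ j → x j - c) i ≡ Φ a b k x i
  Φ-shift x c i = cancel (x (orbit (toℕ i))) (x (orbit (toℕ i ℕ.+ 1))) c β
    where
    cancel : ∀ p q c d → ((p - c) - (q - c)) + d ≡ (p - q) + d
    cancel = solve 4 (λ p q c d → ((p :- c) :- (q :- c)) :+ d := (p :- q) :+ d) refl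

  Φ-difference : ∀ (x y : Fin a → ℚ) i →
    x (orbit (toℕ i ℕ.+ 1)) - y (orbit (toℕ i ℕ.+ 1))
      ≡ (x (orbit (toℕ i)) - y (orbit (toℕ i))) - (Φ a b k x i - Φ a b k y i)
  Φ-difference x y i =
    regroup (x (orbit (toℕ i))) (y (orbit (toℕ i))) (x (orbit (toℕ i ℕ.+ 1))) (y (orbit (toℕ i ℕ.+ 1))) β
    where
    regroup : ∀ p q p′ q′ c → p′ - q′ ≡ (p - q) - (((p - p′) + c) - ((q - q′) + c))
    regroup = solve 5 (λ p q p′ q′ c → p′ :- q′ := (p :- q) :- (((p :- p′) :+ c) :- ((q :- q′) :+ c))) refl

  Σℚ-Φ : ∀ (x : Fin a → ℚ) → Σℚ (Φ a b k x) ≡ fromℕ b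
  Σℚ-Φ x = begin
    Σℚ (Φ a b k x)
      ≡⟨ Σℚ-+ {a} (λ i → g (toℕ i) - g (toℕ i ℕ.+ 1)) (λ _ → β) ⟩
    Σℚ {a} (λ i → g (toℕ i) - g (toℕ i ℕ.+ 1)) + Σℚ {a} (λ _ → β)
      ≡⟨ cong₂ _+_ (Σℚ-telescope a g) (Σℚ-const a β) ⟩
    (g 0 - g a) + fromℕ a * β
      ≡⟨ cong₂ (λ j q → (g 0 - x j) + q) orbit-periodic fromℕ-*-β ⟩
    (g 0 - g 0) + fromℕ b
      ≡⟨ cong (_+ fromℕ b) (ℚP.+-inverseʳ (g 0)) ⟩
    0ℚ + fromℕ b
      ≡⟨ ℚP.+-identityˡ (fromℕ b) ⟩
    fromℕ b
      ∎
    where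
    open ≡-Reasoning
    g : ℕ → ℚ
    g m = x (orbit m)

  Φ-sVec-integral : ∀ i → Integral (Φ a b k (sVec a) i)
  Φ-sVec-integral i
    with subst (+ a ∣_) (regroup (+ toℕ p) (+ toℕ q) (+ toℕ i) (+ b) k)
           (∣m∣n⇒∣m-n (cyc-≡ a (+ toℕ i ℤ.* + b ℤ.+ k)) (cyc-≡ a ((+ toℕ i ℤ.+ + 1) ℤ.* + b ℤ.+ k)))
    where
    p = orbit (toℕ i)
    q = orbit (toℕ i ℕ.+ 1)
    regroup : ∀ r r′ m b k → (r ℤ.- (m ℤ.* b ℤ.+ k)) ℤ.- (r′ ℤ.- ((m ℤ.+ + 1) ℤ.* b ℤ.+ k)) ≡ r ℤ.- r′ ℤ.+ b
    regroup = ℤ-solve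
  ... | divides e r-r′+b≡ea = e , n*p≡q*n⇒p≡q a e (begin
    fromℕ a * ((s p - s q) + β)
      ≡⟨ distribute (fromℕ a) (s p) (s q) β ⟩
    (fromℕ a * s p - fromℕ a * s q) + fromℕ a * β
      ≡⟨ cong₂ _+_ (cong₂ _-_ (fromℕ-*-sVec a p) (fromℕ-*-sVec a q)) fromℕ-*-β ⟩
    ((fromℕ (toℕ p) - h) - (fromℕ (toℕ q) - h)) + fromℕ b
      ≡⟨ cancel (fromℕ (toℕ p)) (fromℕ (toℕ q)) h (fromℕ b) ⟩
    (fromℕ (toℕ p) - fromℕ (toℕ q)) + fromℕ b
      ≡⟨ cong (_+ fromℕ b) (fromℤ-minus (+ toℕ p) (+ toℕ q)) ⟨
    fromℤ (+ toℕ p ℤ.- + toℕ q) + fromℕ b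
      ≡⟨ fromℤ-+ (+ toℕ p ℤ.- + toℕ q) (+ b) ⟨
    fromℤ (+ toℕ p ℤ.- + toℕ q ℤ.+ + b)
      ≡⟨ cong fromℤ r-r′+b≡ea ⟩
    fromℤ (e ℤ.* + a)
      ∎)
    where
    open ≡-Reasoning
    s = sVec a
    p = orbit (toℕ i)
    q = orbit (toℕ i ℕ.+ 1)
    h = (fromℕ a - 1ℚ) * ½
    distribute : ∀ m u v c → m * ((u - v) + c) ≡ (m * u - m * v) + m * c
    distribute = solve 4 (λ m u v c → m :* ((u :- v) :+ c) := (m :* u :- m :* v) :+ m :* c) refl
    cancel : ∀ u v h c → ((u - h) - (v - h)) + c ≡ (u - v) + c
    cancel = solve 4 (λ u v h c → ((u :- h) :- (v :- h)) :+ c := (u :- v) :+ c) refl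

  Φ-lattice-integral : ∀ (x : Fin a → ℚ) → InSLattice a x → ∀ i → Integral (Φ a b k x i)
  Φ-lattice-integral x (c , _ , x≗c+s) i =
    subst Integral (sym (trans (Φ-cong x≗c+s i) (Φ-+ (λ j → fromℤ (c j)) (sVec a) i)))
      (integral-+ (integral-minus (c (orbit (toℕ i)) , refl) (c (orbit (toℕ i ℕ.+ 1)) , refl)) (Φ-sVec-integral i))

module Φ-bijective (a b : ℕ) .{{_ : NonZero a}} (coprime : Coprime a b) (k : ℤ) where
  open Φ-basics a b k public

  b⁻¹ : ℤ
  b⁻¹ = proj₁ (bézout-inverse coprime)

  a∣bb⁻¹-1 : + a ∣ + b ℤ.* b⁻¹ ℤ.- + 1
  a∣bb⁻¹-1 = proj₂ (bézout-inverse coprime)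

  orbit⁻¹ : Fin a → Fin a
  orbit⁻¹ j = cyc a ((+ toℕ j ℤ.- k) ℤ.* b⁻¹)

  orbit-orbit⁻¹ : ∀ j → orbit (toℕ (orbit⁻¹ j)) ≡ j
  orbit-orbit⁻¹ j = trans (cyc-cong a (+ toℕ (cyc a u) ℤ.* + b ℤ.+ k) (+ toℕ j) a∣) (cyc-toℕ a j)
    where
    u = (+ toℕ j ℤ.- k) ℤ.* b⁻¹
    regroup : ∀ r j k b b⁻¹ →
              (r ℤ.- (j ℤ.- k) ℤ.* b⁻¹) ℤ.* b ℤ.+ (j ℤ.- k) ℤ.* (b ℤ.* b⁻¹ ℤ.- + 1) ≡ (r ℤ.* b ℤ.+ k) ℤ.- j
    regroup = ℤ-solve
    a∣ : + a ∣ (+ toℕ (cyc a u) ℤ.* + b ℤ.+ k) ℤ.- + toℕ j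
    a∣ = subst (+ a ∣_) (regroup (+ toℕ (cyc a u)) (+ toℕ j) k (+ b) b⁻¹)
           (∣m∣n⇒∣m+n (∣m⇒∣m*n (+ b) (cyc-≡ a u)) (∣n⇒∣m*n (+ toℕ j ℤ.- k) a∣bb⁻¹-1))

  orbit⁻¹-orbit : ∀ i → orbit⁻¹ (orbit (toℕ i)) ≡ i
  orbit⁻¹-orbit i = trans (cyc-cong a ((+ toℕ (cyc a v) ℤ.- k) ℤ.* b⁻¹) (+ toℕ i) a∣) (cyc-toℕ a i)
    where
    v = + toℕ i ℤ.* + b ℤ.+ k
    regroup : ∀ r i b k b⁻¹ →
              (r ℤ.- (i ℤ.* b ℤ.+ k)) ℤ.* b⁻¹ ℤ.+ i ℤ.* (b ℤ.* b⁻¹ ℤ.- + 1) ≡ (r ℤ.- k) ℤ.* b⁻¹ ℤ.- i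
    regroup = ℤ-solve
    a∣ : + a ∣ (+ toℕ (cyc a v) ℤ.- k) ℤ.* b⁻¹ ℤ.- + toℕ i
    a∣ = subst (+ a ∣_) (regroup (+ toℕ (cyc a v)) (+ toℕ i) (+ b) k b⁻¹)
           (∣m∣n⇒∣m+n (∣m⇒∣m*n b⁻¹ (cyc-≡ a v)) (∣n⇒∣m*n (+ toℕ i) a∣bb⁻¹-1))

  toℕ-orbit⁻¹-orbit : ∀ {m} → m ℕ.< a → toℕ (orbit⁻¹ (orbit m)) ≡ m
  toℕ-orbit⁻¹-orbit {m} m<a = begin
    toℕ (orbit⁻¹ (orbit m))                      ≡⟨ cong (toℕ ∘ orbit⁻¹ ∘ orbit) (FinP.toℕ-fromℕ< m<a) ⟨
    toℕ (orbit⁻¹ (orbit (toℕ (Fin.fromℕ< m<a)))) ≡⟨ cong toℕ (orbit⁻¹-orbit (Fin.fromℕ< m<a)) ⟩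
    toℕ (Fin.fromℕ< m<a)                         ≡⟨ FinP.toℕ-fromℕ< m<a ⟩
    m                                            ∎
    where open ≡-Reasoning

  Σℚ-orbit : ∀ (x : Fin a → ℚ) → Σℚ {a} (λ i → x (orbit (toℕ i))) ≡ Σℚ x
  Σℚ-orbit = Σℚ-permute {a} (orbit ∘ toℕ) orbit⁻¹ orbit-orbit⁻¹ orbit⁻¹-orbit

  orbit-induction : (P : Fin a → Set) → P (orbit 0) →
                    (∀ i → P (orbit (toℕ i)) → P (orbit (toℕ i ℕ.+ 1))) → ∀ j → P j
  orbit-induction P base step j = subst P (orbit-orbit⁻¹ j) (along (toℕ (orbit⁻¹ j)) (FinP.toℕ<n (orbit⁻¹ j)))
    where
    along : ∀ m → m ℕ.< a → P (orbit m)
    along zero    _     = base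
    along (suc m) 1+m<a = subst (P ∘ orbit) (trans (cong (ℕ._+ 1) (FinP.toℕ-fromℕ< m<a)) (ℕP.+-comm m 1))
                            (step i (subst (P ∘ orbit) (sym (FinP.toℕ-fromℕ< m<a)) (along m m<a)))
      where
      m<a = ℕP.<⇒≤ 1+m<a
      i = Fin.fromℕ< m<a

  orbit-interpolation : ∀ (h : ℕ → ℚ) → h a ≡ h 0 → ∀ {m} → m ℕ.≤ a → h (toℕ (orbit⁻¹ (orbit m))) ≡ h m
  orbit-interpolation h ha≡h0 m≤a with ℕP.m≤n⇒m<n∨m≡n m≤a
  ... | inj₁ m<a  = cong h (toℕ-orbit⁻¹-orbit m<a)
  ... | inj₂ refl = trans (cong (h ∘ toℕ ∘ orbit⁻¹) orbit-periodic)
                      (trans (cong h (toℕ-orbit⁻¹-orbit (ℕ.>-nonZero⁻¹ a))) (sym ha≡h0))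

  Φ-kernel : ∀ (x y : Fin a → ℚ) → (∀ i → Φ a b k x i ≡ Φ a b k y i) →
             ∀ j → x j - y j ≡ x (orbit 0) - y (orbit 0)
  Φ-kernel x y Φx≗Φy = orbit-induction (λ j → x j - y j ≡ δ) refl step
    where
    δ = x (orbit 0) - y (orbit 0)
    step : ∀ i → x (orbit (toℕ i)) - y (orbit (toℕ i)) ≡ δ →
                 x (orbit (toℕ i ℕ.+ 1)) - y (orbit (toℕ i ℕ.+ 1)) ≡ δ
    step i eq = begin
      x (orbit (toℕ i ℕ.+ 1)) - y (orbit (toℕ i ℕ.+ 1))                   ≡⟨ Φ-difference x y i ⟩
      (x (orbit (toℕ i)) - y (orbit (toℕ i))) - (Φ a b k x i - Φ a b k y i) ≡⟨ cong₂ _-_ eq (p≡q⇒p-q≡0 (Φx≗Φy i)) ⟩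
      δ - 0ℚ                                                              ≡⟨ ℚP.+-identityʳ δ ⟩
      δ                                                                   ∎
      where open ≡-Reasoning

  Φ-injective : ∀ (x y : Fin a → ℚ) → H₀ a x → H₀ a y → (∀ i → Φ a b k x i ≡ Φ a b k y i) → ∀ j → x j ≡ y j
  Φ-injective x y Σx≡0 Σy≡0 Φx≗Φy j = p-q≡0⇒p≡q (x j) (y j) (trans (Φ-kernel x y Φx≗Φy j) δ≡0)
    where
    δ = x (orbit 0) - y (orbit 0)
    δ≡0 : δ ≡ 0ℚ
    δ≡0 = fromℕ-*-cancelˡ a (begin
      fromℕ a * δ              ≡⟨ Σℚ-const a δ ⟨
      Σℚ {a} (λ _ → δ)         ≡⟨ Σℚ-cong (Φ-kernel x y Φx≗Φy) ⟨
      Σℚ (λ j → x j - y j)     ≡⟨ Σℚ-minus x y ⟩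
      Σℚ x - Σℚ y              ≡⟨ cong₂ _-_ Σx≡0 Σy≡0 ⟩
      0ℚ                       ≡⟨ ℚP.*-zeroʳ (fromℕ a) ⟨
      fromℕ a * 0ℚ             ∎)
      where open ≡-Reasoning

  Φ-preimage : ∀ (z : Fin a → ℚ) → Hb a b z → ∃[ x ] ∀ i → Φ a b k x i ≡ z i
  Φ-preimage z Σz≡b = x , Φx≗z
    where
    -- x reads the partial sums h along the orbit; h a = h 0 = 0 closes the cycle.
    F : ℕ → ℚ
    F l = β - z (cyc a (+ l))
    h : ℕ → ℚ
    h m = Σℚ {m} (F ∘ toℕ)
    x : Fin a → ℚ
    x j = h (toℕ (orbit⁻¹ j))
    ha≡0 : h a ≡ 0ℚ
    ha≡0 = begin
      Σℚ {a} (λ l → β - z (cyc a (+ toℕ l)))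
        ≡⟨ Σℚ-minus {a} (λ _ → β) (λ l → z (cyc a (+ toℕ l))) ⟩
      Σℚ {a} (λ _ → β) - Σℚ {a} (λ l → z (cyc a (+ toℕ l)))
        ≡⟨ cong₂ _-_ (Σℚ-const a β) (Σℚ-cong {a} (λ l → cong z (cyc-toℕ a l))) ⟩
      fromℕ a * β - Σℚ z
        ≡⟨ cong₂ _-_ fromℕ-*-β Σz≡b ⟩
      fromℕ b - fromℕ b
        ≡⟨ ℚP.+-inverseʳ (fromℕ b) ⟩
      0ℚ
        ∎
      where open ≡-Reasoning
    x∘orbit : ∀ {m} → m ℕ.≤ a → x (orbit m) ≡ h m
    x∘orbit = orbit-interpolation h ha≡0
    Φx≗z : ∀ i → Φ a b k x i ≡ z i
    Φx≗z i = begin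
      (x (orbit (toℕ i)) - x (orbit (toℕ i ℕ.+ 1))) + β
        ≡⟨ cong₂ (λ p q → (p - q) + β) (x∘orbit (ℕP.<⇒≤ (FinP.toℕ<n i)))
                                       (x∘orbit (subst (ℕ._≤ a) (ℕP.+-comm 1 (toℕ i)) (FinP.toℕ<n i))) ⟩
      (h (toℕ i) - h (toℕ i ℕ.+ 1)) + β
        ≡⟨ cong (λ m → (h (toℕ i) - h m) + β) (ℕP.+-comm (toℕ i) 1) ⟩
      (h (toℕ i) - h (suc (toℕ i))) + β
        ≡⟨ cong (λ s → (h (toℕ i) - s) + β) (Σℚ-snoc (toℕ i) F) ⟩
      (h (toℕ i) - (h (toℕ i) + (β - z (cyc a (+ toℕ i))))) + β
        ≡⟨ cancel (h (toℕ i)) β (z (cyc a (+ toℕ i))) ⟩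
      z (cyc a (+ toℕ i))
        ≡⟨ cong z (cyc-toℕ a i) ⟩
      z i
        ∎
      where
      open ≡-Reasoning
      cancel : ∀ s c w → (s - (s + (c - w))) + c ≡ w
      cancel = solve 3 (λ s c w → (s :- (s :+ (c :- w))) :+ c := w) refl

  Φ-surjective : ∀ (z : Fin a → ℚ) → Hb a b z → ∃[ x ] H₀ a x × ∀ i → Φ a b k x i ≡ z i
  Φ-surjective z Σz≡b =
    (λ j → v j - mean v) , Σℚ-centered v , λ i → trans (Φ-shift v (mean v) i) (Φv≗z i)
    where
    v = proj₁ (Φ-preimage z Σz≡b)
    Φv≗z = proj₂ (Φ-preimage z Σz≡b)

  Φ-gap : ∀ (x : Fin a → ℚ) j → at a x (+ toℕ j ℤ.+ + b) - x j ≡ β - Φ a b k x (orbit⁻¹ j)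
  Φ-gap x j = begin
    at a x (+ toℕ j ℤ.+ + b) - x j
      ≡⟨ cong (λ j′ → at a x (+ toℕ j′ ℤ.+ + b) - x j′) (orbit-orbit⁻¹ j) ⟨
    x (cyc a (+ toℕ (orbit m) ℤ.+ + b)) - x (orbit m)
      ≡⟨ cong (λ j′ → x j′ - x (orbit m)) (cyc-orbit+b m) ⟩
    x (orbit (m ℕ.+ 1)) - x (orbit m)
      ≡⟨ flip (x (orbit m)) (x (orbit (m ℕ.+ 1))) β ⟩
    β - ((x (orbit m) - x (orbit (m ℕ.+ 1))) + β)
      ∎
    where
    open ≡-Reasoning
    m = toℕ (orbit⁻¹ j)
    flip : ∀ p q c → q - p ≡ c - ((p - q) + c)
    flip = solve 3 (λ p q c → q :- p := c :- ((p :- q) :+ c)) refl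

  gap≤β⇒Φ-nonNeg : ∀ (x : Fin a → ℚ) → (∀ j → at a x (+ toℕ j ℤ.+ + b) - x j ≤ β) →
                   ∀ i → 0ℚ ≤ Φ a b k x i
  gap≤β⇒Φ-nonNeg x gap≤β i =
    p-q≤p⇒0≤q (subst (_≤ β) (trans (Φ-gap x j) (cong (λ i′ → β - Φ a b k x i′) (orbit⁻¹-orbit i))) (gap≤β j))
    where j = orbit (toℕ i)

  Φ-nonNeg⇒gap≤β : ∀ (x : Fin a → ℚ) → (∀ i → 0ℚ ≤ Φ a b k x i) →
                   ∀ j → at a x (+ toℕ j ℤ.+ + b) - x j ≤ β
  Φ-nonNeg⇒gap≤β x 0≤Φx j = subst (_≤ β) (sym (Φ-gap x j)) (0≤q⇒p-q≤p (0≤Φx (orbit⁻¹ j)))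

  Φ-ratSimplex : ∀ (x : Fin a → ℚ) → RatSimplex a b x → StdSimplex a b (Φ a b k x)
  Φ-ratSimplex x (_ , gap≤β) = Σℚ-Φ x , gap≤β⇒Φ-nonNeg x gap≤β

  Φ-onto-stdSimplex : ∀ (z : Fin a → ℚ) → StdSimplex a b z →
                      ∃[ x ] RatSimplex a b x × ∀ i → Φ a b k x i ≡ z i
  Φ-onto-stdSimplex z (Σz≡b , 0≤z) =
    let (x , Σx≡0 , Φx≗z) = Φ-surjective z Σz≡b
    in x , (Σx≡0 , Φ-nonNeg⇒gap≤β x (λ i → subst (0ℚ ≤_) (sym (Φx≗z i)) (0≤z i))) , Φx≗z

  Σℚ-index-Δ : ∀ (x : Fin a → ℚ) → H₀ a x →
    Σℚ {a} (λ i → fromℕ (toℕ i) * (x (orbit (toℕ i)) - x (orbit (toℕ i ℕ.+ 1)))) ≡ - (fromℕ a * x (orbit 0))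
  Σℚ-index-Δ x Σx≡0 = p+q≡0⇒p≡-q _ _ (begin
    W + fromℕ a * g 0                ≡⟨ cong (λ j → W + fromℕ a * x j) orbit-periodic ⟨
    W + fromℕ a * g a                ≡⟨ Σℚ-weighted-telescope a g ⟩
    Σℚ {a} (λ i → g (toℕ i ℕ.+ 1))   ≡⟨ Σℚ-cong {a} (λ i → unshift (g (toℕ i)) (g (toℕ i ℕ.+ 1))) ⟩
    Σℚ (λ i → g (toℕ i) - Δ i)       ≡⟨ Σℚ-minus {a} (g ∘ toℕ) Δ ⟩
    Σℚ {a} (g ∘ toℕ) - Σℚ Δ          ≡⟨ cong₂ _-_ (trans (Σℚ-orbit x) Σx≡0) (Σℚ-telescope a g) ⟩
    0ℚ - (g 0 - g a)                 ≡⟨ cong (λ j → 0ℚ - (g 0 - x j)) orbit-periodic ⟩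
    0ℚ - (g 0 - g 0)                 ≡⟨ cong (_-_ 0ℚ) (ℚP.+-inverseʳ (g 0)) ⟩
    0ℚ                               ∎)
    where
    open ≡-Reasoning
    g : ℕ → ℚ
    g m = x (orbit m)
    Δ : Fin a → ℚ
    Δ i = g (toℕ i) - g (toℕ i ℕ.+ 1)
    W = Σℚ (λ i → fromℕ (toℕ i) * Δ i)
    unshift : ∀ p q → q ≡ p - (p - q)
    unshift = solve 2 (λ p q → q := p :- (p :- q)) refl

  Σℚ-index-Φ : ∀ (x : Fin a → ℚ) → H₀ a x →
    fromℕ a * x (orbit 0) + Σℚ (λ i → fromℕ (toℕ i) * Φ a b k x i) ≡ fromℕ b * (fromℕ a - 1ℚ) * ½
  Σℚ-index-Φ x Σx≡0 = begin
    fromℕ a * g 0 + Σℚ (λ i → fromℕ (toℕ i) * (Δ i + β))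
      ≡⟨ cong (_+_ (fromℕ a * g 0)) (trans (Σℚ-cong (λ i → ℚP.*-distribˡ-+ (fromℕ (toℕ i)) (Δ i) β))
                                           (Σℚ-+ (λ i → fromℕ (toℕ i) * Δ i) (λ i → fromℕ (toℕ i) * β))) ⟩
    fromℕ a * g 0 + (Σℚ (λ i → fromℕ (toℕ i) * Δ i) + Σℚ {a} (λ i → fromℕ (toℕ i) * β))
      ≡⟨ cong₂ (λ u v → fromℕ a * g 0 + (u + v)) (Σℚ-index-Δ x Σx≡0)
               (trans (Σℚ-*ʳ {a} (λ i → fromℕ (toℕ i)) β) (cong (_* β) (Σℚ-indices a))) ⟩
    fromℕ a * g 0 + (- (fromℕ a * g 0) + fromℕ a * (fromℕ a - 1ℚ) * ½ * β)
      ≡⟨ regroup (fromℕ a) (g 0) β ⟩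
    (fromℕ a * β) * (fromℕ a - 1ℚ) * ½
      ≡⟨ cong (λ u → u * (fromℕ a - 1ℚ) * ½) fromℕ-*-β ⟩
    fromℕ b * (fromℕ a - 1ℚ) * ½
      ∎
    where
    open ≡-Reasoning
    g : ℕ → ℚ
    g m = x (orbit m)
    Δ : Fin a → ℚ
    Δ i = g (toℕ i) - g (toℕ i ℕ.+ 1)
    regroup : ∀ n g c → n * g + (- (n * g) + n * (n - 1ℚ) * ½ * c) ≡ (n * c) * (n - 1ℚ) * ½
    regroup = solve 3 (λ n g c → n :* g :+ (:- (n :* g) :+ n :* (n :- con 1ℚ) :* con ½ :* c)
                       := (n :* c) :* (n :- con 1ℚ) :* con ½) refl

module Φ-lattice (a b : ℕ) .{{_ : NonZero a}} (coprime : Coprime a b) (k : ℤ) (kcond : KCond a b k) where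
  open Φ-bijective a b coprime k public

  K H r₀ : ℕ
  K  = proj₁ (halfB+1-spec a b coprime)
  H  = halfB+1 a b
  r₀ = toℕ (orbit 0)

  D : ℤ
  D = + a ℤ.* + K ℤ.- + H ℤ.- + r₀

  a∣D : + a ∣ D
  a∣D = subst (+ a ∣_) (regroup (+ a) (+ K) (+ H) (+ r₀) k (+ b))
          (∣m∣n⇒∣m-n (∣m∣n⇒∣m-n (∣m⇒∣m*n (+ K) (∣-refl {+ a})) (∣ᵤ⇒∣ kcond)) (cyc-≡ a (+ 0 ℤ.* + b ℤ.+ k)))
    where
    regroup : ∀ a K H r k b → a ℤ.* K ℤ.- (k ℤ.+ H) ℤ.- (r ℤ.- (+ 0 ℤ.* b ℤ.+ k)) ≡ a ℤ.* K ℤ.- H ℤ.- r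
    regroup = ℤ-solve

  halfB+1-identity : fromℕ b * (fromℕ a - 1ℚ) * ½ + (fromℕ a - 1ℚ) * ½ ≡ fromℕ a * fromℕ K - fromℕ H
  halfB+1-identity = begin
    fromℕ b * (fromℕ a - 1ℚ) * ½ + (fromℕ a - 1ℚ) * ½
      ≡⟨ expand (fromℕ a) (fromℕ b) (fromℕ H) ⟩
    ½ * ((fromℕ a - 1ℚ) * (fromℕ b + 1ℚ) + (fromℕ H + fromℕ H)) - fromℕ H
      ≡⟨ cong (λ u → ½ * u - fromℕ H) cast ⟩
    ½ * (fromℕ a * fromℕ K + fromℕ a * fromℕ K) - fromℕ H
      ≡⟨ halve (fromℕ a * fromℕ K) (fromℕ H) ⟩
    fromℕ a * fromℕ K - fromℕ H
      ∎
    where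
    open ≡-Reasoning
    expand : ∀ a b h → b * (a - 1ℚ) * ½ + (a - 1ℚ) * ½ ≡ ½ * ((a - 1ℚ) * (b + 1ℚ) + (h + h)) - h
    expand = solve 3 (λ a b h → b :* (a :- con 1ℚ) :* con ½ :+ (a :- con 1ℚ) :* con ½
                      := con ½ :* ((a :- con 1ℚ) :* (b :+ con 1ℚ) :+ (h :+ h)) :- h) refl
    halve : ∀ u h → ½ * (u + u) - h ≡ u - h
    halve = solve 2 (λ u h → con ½ :* (u :+ u) :- h := u :- h) refl
    cast : (fromℕ a - 1ℚ) * (fromℕ b + 1ℚ) + (fromℕ H + fromℕ H) ≡ fromℕ a * fromℕ K + fromℕ a * fromℕ K
    cast = begin
      (fromℕ a - 1ℚ) * (fromℕ b + 1ℚ) + (fromℕ H + fromℕ H)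
        ≡⟨ cong₂ (λ u v → u * v + (fromℕ H + fromℕ H)) (fromℕ-pred a) (fromℤ-+ (+ b) (+ 1)) ⟨
      fromℕ (a ℕ.∸ 1) * fromℕ (b ℕ.+ 1) + (fromℕ H + fromℕ H)
        ≡⟨ trans (fromℤ-+ (+ ((a ℕ.∸ 1) ℕ.* (b ℕ.+ 1))) (+ (H ℕ.+ H)))
                 (cong₂ _+_ (fromℕ-* (a ℕ.∸ 1) (b ℕ.+ 1)) (fromℤ-+ (+ H) (+ H))) ⟨
      fromℕ ((a ℕ.∸ 1) ℕ.* (b ℕ.+ 1) ℕ.+ (H ℕ.+ H))
        ≡⟨ cong fromℕ (proj₂ (halfB+1-spec a b coprime)) ⟩
      fromℕ (a ℕ.* K ℕ.+ a ℕ.* K)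
        ≡⟨ trans (fromℤ-+ (+ (a ℕ.* K)) (+ (a ℕ.* K))) (cong₂ _+_ (fromℕ-* a K) (fromℕ-* a K)) ⟩
      fromℕ a * fromℕ K + fromℕ a * fromℕ K
        ∎

  scaled-offset : ∀ (x : Fin a → ℚ) (z : Fin a → ℕ) → H₀ a x → (∀ i → Φ a b k x i ≡ fromℕ (z i)) →
    fromℕ a * (x (orbit 0) - sVec a (orbit 0)) ≡ fromℤ (D ℤ.- + Σℕ (λ i → toℕ i ℕ.* z i))
  scaled-offset x z Σx≡0 Φx≗z = begin
    fromℕ a * (x₀ - s₀)
      ≡⟨ regroup (fromℕ a) x₀ s₀ S ⟩
    (fromℕ a * x₀ + S) - fromℕ a * s₀ - S
      ≡⟨ cong₂ (λ u v → u - v - S) (Σℚ-index-Φ x Σx≡0) (fromℕ-*-sVec a (orbit 0)) ⟩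
    fromℕ b * (fromℕ a - 1ℚ) * ½ - (fromℕ r₀ - (fromℕ a - 1ℚ) * ½) - S
      ≡⟨ cong (_- S) (swap (fromℕ b * (fromℕ a - 1ℚ) * ½) (fromℕ r₀) ((fromℕ a - 1ℚ) * ½)) ⟩
    (fromℕ b * (fromℕ a - 1ℚ) * ½ + (fromℕ a - 1ℚ) * ½) - fromℕ r₀ - S
      ≡⟨ cong₂ (λ u v → u - fromℕ r₀ - v) halfB+1-identity (Σℚ-index-fromℕ (Φ a b k x) z Φx≗z) ⟩
    fromℕ a * fromℕ K - fromℕ H - fromℕ r₀ - fromℕ N
      ≡⟨ cast ⟨
    fromℤ (D ℤ.- + N)
      ∎
    where
    open ≡-Reasoning
    x₀ = x (orbit 0)
    s₀ = sVec a (orbit 0)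
    S = Σℚ (λ i → fromℕ (toℕ i) * Φ a b k x i)
    N = Σℕ (λ i → toℕ i ℕ.* z i)
    regroup : ∀ a x s S → a * (x - s) ≡ (a * x + S) - a * s - S
    regroup = solve 4 (λ a x s S → a :* (x :- s) := (a :* x :+ S) :- a :* s :- S) refl
    swap : ∀ u r h → u - (r - h) ≡ (u + h) - r
    swap = solve 3 (λ u r h → u :- (r :- h) := (u :+ h) :- r) refl
    cast : fromℤ (D ℤ.- + N) ≡ fromℕ a * fromℕ K - fromℕ H - fromℕ r₀ - fromℕ N
    cast = begin
      fromℤ (D ℤ.- + N)
        ≡⟨ fromℤ-minus D (+ N) ⟩
      fromℤ (+ a ℤ.* + K ℤ.- + H ℤ.- + r₀) - fromℕ N
        ≡⟨ cong (_- fromℕ N) (fromℤ-minus (+ a ℤ.* + K ℤ.- + H) (+ r₀)) ⟩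
      fromℤ (+ a ℤ.* + K ℤ.- + H) - fromℕ r₀ - fromℕ N
        ≡⟨ cong (λ u → u - fromℕ r₀ - fromℕ N) (fromℤ-minus (+ a ℤ.* + K) (+ H)) ⟩
      fromℤ (+ a ℤ.* + K) - fromℕ H - fromℕ r₀ - fromℕ N
        ≡⟨ cong (λ u → u - fromℕ H - fromℕ r₀ - fromℕ N) (fromℤ-* (+ a) (+ K)) ⟩
      fromℕ a * fromℕ K - fromℕ H - fromℕ r₀ - fromℕ N
        ∎

  offset-integral⇒a∣N : ∀ (x : Fin a → ℚ) (z : Fin a → ℕ) → H₀ a x → (∀ i → Φ a b k x i ≡ fromℕ (z i)) →
    Integral (x (orbit 0) - sVec a (orbit 0)) → a ℕ∣.∣ Σℕ (λ i → toℕ i ℕ.* z i)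
  offset-integral⇒a∣N x z Σx≡0 Φx≗z (c₀ , x₀-s₀≡c₀) =
    ∣⇒∣ᵤ (subst (+ a ∣_) D-ac₀≡N (∣m∣n⇒∣m-n a∣D (∣m⇒∣m*n c₀ (∣-refl {+ a}))))
    where
    N = Σℕ (λ i → toℕ i ℕ.* z i)
    ac₀≡D-N : + a ℤ.* c₀ ≡ D ℤ.- + N
    ac₀≡D-N = fromℤ-injective (begin
      fromℤ (+ a ℤ.* c₀)                          ≡⟨ fromℤ-* (+ a) c₀ ⟩
      fromℕ a * fromℤ c₀                          ≡⟨ cong (_*_ (fromℕ a)) x₀-s₀≡c₀ ⟨
      fromℕ a * (x (orbit 0) - sVec a (orbit 0))  ≡⟨ scaled-offset x z Σx≡0 Φx≗z ⟩
      fromℤ (D ℤ.- + N)                           ∎)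
      where open ≡-Reasoning
    cancel : ∀ d n → d ℤ.- (d ℤ.- n) ≡ n
    cancel = ℤ-solve
    D-ac₀≡N : D ℤ.- + a ℤ.* c₀ ≡ + N
    D-ac₀≡N = trans (cong (ℤ._-_ D) ac₀≡D-N) (cancel D (+ N))

  a∣N⇒offset-integral : ∀ (x : Fin a → ℚ) (z : Fin a → ℕ) → H₀ a x → (∀ i → Φ a b k x i ≡ fromℕ (z i)) →
    a ℕ∣.∣ Σℕ (λ i → toℕ i ℕ.* z i) → Integral (x (orbit 0) - sVec a (orbit 0))
  a∣N⇒offset-integral x z Σx≡0 Φx≗z (ℕ∣.divides q N≡qa) with a∣D
  ... | divides M D≡Ma =
    M ℤ.- + q , n*p≡q*n⇒p≡q a (M ℤ.- + q) (trans (scaled-offset x z Σx≡0 Φx≗z) (cong fromℤ D-N≡[M-q]a))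
    where
    factor : ∀ M q a → M ℤ.* a ℤ.- q ℤ.* a ≡ (M ℤ.- q) ℤ.* a
    factor = ℤ-solve
    D-N≡[M-q]a : D ℤ.- + Σℕ (λ i → toℕ i ℕ.* z i) ≡ (M ℤ.- + q) ℤ.* + a
    D-N≡[M-q]a = trans (cong₂ ℤ._-_ D≡Ma (trans (cong +_ N≡qa) (ℤP.pos-* q a))) (factor M (+ q) (+ a))

  SC⇒TD : ∀ (x : Fin a → ℚ) → SC a b x → ∃[ z ] TD a b z × ∀ i → Φ a b k x i ≡ toℚv z i
  SC⇒TD x (lattice@(c , _ , x≗c+s) , gap≤β) = z , (Σz≡b , a∣N) , Φx≗z
    where
    natural : ∀ i → ∃[ n ] Φ a b k x i ≡ fromℕ n
    natural i = integral-nonNeg⇒fromℕ (Φ-lattice-integral x lattice i) (gap≤β⇒Φ-nonNeg x gap≤β i)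
    z : Fin a → ℕ
    z i = proj₁ (natural i)
    Φx≗z : ∀ i → Φ a b k x i ≡ fromℕ (z i)
    Φx≗z i = proj₂ (natural i)
    Σz≡b : Σℕ z ≡ b
    Σz≡b = ℤP.+-injective (fromℤ-injective (trans (sym (fromℕ-Σℕ z)) (trans (sym (Σℚ-cong Φx≗z)) (Σℚ-Φ x))))
    cancel : ∀ c s → (c + s) - s ≡ c
    cancel = solve 2 (λ c s → (c :+ s) :- s := c) refl
    offset-integral : Integral (x (orbit 0) - sVec a (orbit 0))
    offset-integral = c (orbit 0) ,
      trans (cong (_- sVec a (orbit 0)) (x≗c+s (orbit 0))) (cancel (fromℤ (c (orbit 0))) (sVec a (orbit 0)))
    a∣N : a ℕ∣.∣ Σℕ (λ i → toℕ i ℕ.* z i)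
    a∣N = offset-integral⇒a∣N x z (inSLattice⇒H₀ a x lattice) Φx≗z offset-integral

  TD⇒SC : ∀ (z : Fin a → ℕ) → TD a b z → ∃[ x ] SC a b x × ∀ i → Φ a b k x i ≡ toℚv z i
  TD⇒SC z (Σz≡b , a∣N) = x , ((c , Σc≡0 , x≗c+s) , gap≤β) , Φx≗z
    where
    preimage = Φ-surjective (toℚv z) (trans (fromℕ-Σℕ z) (cong fromℕ Σz≡b))
    x = proj₁ preimage
    Σx≡0 = proj₁ (proj₂ preimage)
    Φx≗z = proj₂ (proj₂ preimage)
    d : Fin a → ℚ
    d j = x j - sVec a j
    step : ∀ i → Integral (d (orbit (toℕ i))) → Integral (d (orbit (toℕ i ℕ.+ 1)))
    step i dᵢ-integral = subst Integral (sym (Φ-difference x (sVec a) i))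
      (integral-minus dᵢ-integral
        (integral-minus (subst Integral (sym (Φx≗z i)) (integral-fromℕ (z i))) (Φ-sVec-integral i)))
    d-integral : ∀ j → Integral (d j)
    d-integral = orbit-induction (Integral ∘ d) (a∣N⇒offset-integral x z Σx≡0 Φx≗z a∣N) step
    c : Fin a → ℤ
    c j = proj₁ (d-integral j)
    split : ∀ p s → p ≡ (p - s) + s
    split = solve 2 (λ p s → p := (p :- s) :+ s) refl
    x≗c+s : ∀ j → x j ≡ fromℤ (c j) + sVec a j
    x≗c+s j = trans (split (x j) (sVec a j)) (cong (_+ sVec a j) (proj₂ (d-integral j)))
    Σc≡0 : Σℤ c ≡ + 0
    Σc≡0 = fromℤ-injective (begin
      fromℤ (Σℤ c)               ≡⟨ fromℤ-Σℤ c ⟨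
      Σℚ (λ j → fromℤ (c j))     ≡⟨ Σℚ-cong (λ j → sym (proj₂ (d-integral j))) ⟩
      Σℚ d                       ≡⟨ Σℚ-minus x (sVec a) ⟩
      Σℚ x - Σℚ (sVec a)         ≡⟨ cong₂ _-_ Σx≡0 (Σℚ-sVec a) ⟩
      0ℚ                         ∎)
      where open ≡-Reasoning
    gap≤β : ∀ j → at a x (+ toℕ j ℤ.+ + b) - x j ≤ β
    gap≤β = Φ-nonNeg⇒gap≤β x (λ i → subst (0ℚ ≤_) (sym (Φx≗z i)) (fromℕ-nonNeg (z i)))

mainTheorem3 : (a b : ℕ) .{{_ : NonZero a}} .{{_ : NonZero b}} → Coprime a b →
    (k : ℤ) → KCond a b k →
    -- Φ is affine-linear
    (∀ (x y : Fin a → ℚ) (t : ℚ) (i : Fin a) →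
       Φ a b k (λ j → t * x j + (1ℚ - t) * y j) i ≡ t * Φ a b k x i + (1ℚ - t) * Φ a b k y i)
    -- Φ maps {Σ x = 0} into {Σ z = b}
    × (∀ (x : Fin a → ℚ) → H₀ a x → Hb a b (Φ a b k x))
    -- injective there
    × (∀ (x y : Fin a → ℚ) → H₀ a x → H₀ a y →
         (∀ i → Φ a b k x i ≡ Φ a b k y i) → ∀ i → x i ≡ y i)
    -- onto {Σ z = b}
    × (∀ (z : Fin a → ℚ) → Hb a b z →
         Σ (Fin a → ℚ) λ x → H₀ a x × (∀ i → Φ a b k x i ≡ z i))
    -- maps the rational simplex into the standard simplex
    × (∀ (x : Fin a → ℚ) → RatSimplex a b x → StdSimplex a b (Φ a b k x))
    -- and onto it
    × (∀ (z : Fin a → ℚ) → StdSimplex a b z →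
         Σ (Fin a → ℚ) λ x → RatSimplex a b x × (∀ i → Φ a b k x i ≡ z i))
    -- SC_a(b) is mapped into TD_a(b)
    × (∀ (x : Fin a → ℚ) → SC a b x →
         Σ (Fin a → ℕ) λ z → TD a b z × (∀ i → Φ a b k x i ≡ toℚv z i))
    -- injectively
    × (∀ (x y : Fin a → ℚ) → SC a b x → SC a b y →
         (∀ i → Φ a b k x i ≡ Φ a b k y i) → ∀ i → x i ≡ y i)
    -- and onto TD_a(b)
    × (∀ (z : Fin a → ℕ) → TD a b z →
         Σ (Fin a → ℚ) λ x → SC a b x × (∀ i → Φ a b k x i ≡ toℚv z i))
mainTheorem3 a b coprime k kcond =
    Φ-affine
  , (λ x _ → Σℚ-Φ x)
  , Φ-injective
  , Φ-surjective
  , Φ-ratSimplex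
  , Φ-onto-stdSimplex
  , SC⇒TD
  , (λ x y x∈SC y∈SC → Φ-injective x y (inSLattice⇒H₀ a x (proj₁ x∈SC)) (inSLattice⇒H₀ a y (proj₁ y∈SC)))
  , TD⇒SC
  where open Φ-lattice a b coprime k kcond
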